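{- Let $0<\epsilon\leq\frac{1}{20}$, let $M=\frac{6}{\epsilon}$, and let $k\geq\frac{3}{\epsilon^2}$ be an integer. Let $G$ be a graph with $\Delta(G)\leq k$ whose square is not list $(k+1)$-colorable, but such that the square of every proper subgraph of $G$ is list $(k+1)$-colorable. Then $G$ contains none of the following configurations: (C1) a vertex $u$ of degree $0$ or $1$; (C2) a path $w_1u_1u_2w_2$ with $d(u_1)=d(u_2)=2$, $d(w_1)\leq k-1$ and $d(w_2)\leq k-2$ (where $w_1,w_2$ need not be distinct); (C3) a vertex $u$ with $3\leq d(u)\leq M$ whose neighbors are $v_1,\dots,v_{d(u)-2},x,y$, where each $v_i$ has degree $2$ and its other neighbor $w_i$ satisfies $d(w_i)\leq M$ (the $w_i$ need not be distinct), and $d(x)+d(y)\leq k-M+2$.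
   Context: Graphs are finite and simple; $d(v)$ denotes the degree of $v$ in $G$ and $\Delta(G)$ the maximum degree. The square of $G$ is the graph on $V(G)$ where two distinct vertices are adjacent iff they are adjacent or have a common neighbor in $G$. The square of a graph $H$ is list $(k+1)$-colorable if for every assignment of lists of $k+1$ colors to the vertices of $H$, there is a proper coloring of the square of $H$ with each vertex colored from its list.
   Formalization: The parameter ε ranges over the rationals, so $M=\frac{6}{\epsilon}$ is rational as well. -}

module Defs where

open import Data.Nat as ℕ using (ℕ; suc; _∸_)
open import Data.Bool using (Bool; true; false; if_then_else_)
open import Data.Fin using (Fin)
open import Data.List using (List; length; allFin; map)
open import Data.Nat.ListAction using (sum)
open import Data.List.Membership.Propositional using (_∈_)
open import Data.List.Relation.Unary.Unique.Propositional using (Unique)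
open import Data.Integer using (+_)
open import Data.Rational as ℚ using (ℚ; 0ℚ; _/_; _÷_; _*_; _+_; _-_; 1/_; positive)
open import Data.Rational.Properties using (pos⇒nonZero)
open import Data.Product using (Σ; _×_; ∃; ∃-syntax)
open import Data.Sum using (_⊎_)
open import Relation.Binary.PropositionalEquality using (_≡_; _≢_)

record Graph : Set where
  field
    n     : ℕ
    adj   : Fin n → Fin n → Bool
    sym   : ∀ u v → adj u v ≡ adj v u
    irref : ∀ v → adj v v ≡ false
open Graph public

deg : (G : Graph) → Fin (n G) → ℕ
deg G v = sum (map (λ w → if adj G v w then 1 else 0) (allFin (n G)))

record Subgraph (G : Graph) : Set where
  field
    S      : Fin (n G) → Bool
    E      : Fin (n G) → Fin (n G) → Bool
    E-sym  : ∀ u v → E u v ≡ E v u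
    E-adj  : ∀ u v → E u v ≡ true → adj G u v ≡ true
    E-endˡ : ∀ u v → E u v ≡ true → S u ≡ true
open Subgraph public

whole : (G : Graph) → Subgraph G
whole G = record
  { S = λ _ → true ; E = adj G ; E-sym = sym G
  ; E-adj = λ _ _ e → e ; E-endˡ = λ _ _ _ → _≡_.refl }

Proper : {G : Graph} → Subgraph G → Set
Proper {G} H = (∃[ v ] S H v ≡ false)
             ⊎ (∃[ u ] ∃[ v ] (adj G u v ≡ true × E H u v ≡ false))

SqAdj : {G : Graph} → Subgraph G → Fin (n G) → Fin (n G) → Set
SqAdj H u v = u ≢ v × (E H u v ≡ true ⊎ ∃[ w ] (E H u w ≡ true × E H w v ≡ true))

SqListColourable : {G : Graph} → Subgraph G → ℕ → Set
SqListColourable {G} H k =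
  (L : Fin (n G) → List ℕ) →
  (∀ v → Unique (L v)) → (∀ v → length (L v) ≡ suc k) →
  Σ (Fin (n G) → ℕ) λ c →
    (∀ v → S H v ≡ true → c v ∈ L v) ×
    (∀ u v → SqAdj H u v → c u ≢ c v)

ℕ→ℚ : ℕ → ℚ
ℕ→ℚ m = + m / 1

inv : (ε : ℚ) → 0ℚ ℚ.< ε → ℚ
inv ε p = (1/ ε) {{pos⇒nonZero ε {{positive p}}}}

Mof : (ε : ℚ) → 0ℚ ℚ.< ε → ℚ
Mof ε p = ℕ→ℚ 6 * inv ε p

C1 : Graph → Set
C1 G = ∃[ u ] deg G u ℕ.≤ 1

C2 : Graph → ℕ → Set
C2 G k = ∃[ w₁ ] ∃[ u₁ ] ∃[ u₂ ] ∃[ w₂ ]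
  ( adj G w₁ u₁ ≡ true × adj G u₁ u₂ ≡ true × adj G u₂ w₂ ≡ true
  × w₁ ≢ u₂ × w₂ ≢ u₁
  × deg G u₁ ≡ 2 × deg G u₂ ≡ 2
  × deg G w₁ ℕ.≤ k ∸ 1 × deg G w₂ ℕ.≤ k ∸ 2 )

-- (C3) a vertex u with 3 ≤ d(u) ≤ M whose neighbours are v_1..v_{d(u)-2}, x, y
-- (x, y two distinct neighbours; the v_i are all the other neighbours), each v_i
-- of degree 2 whose other neighbour w_i has d(w_i) ≤ M, and d(x)+d(y) ≤ k-M+2.
C3 : Graph → ℕ → ℚ → Set
C3 G k M = ∃[ u ] ∃[ x ] ∃[ y ]
  ( 3 ℕ.≤ deg G u × ℕ→ℚ (deg G u) ℚ.≤ M
  × adj G u x ≡ true × adj G u y ≡ true × x ≢ y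
  × (∀ v → adj G u v ≡ true → v ≢ x → v ≢ y →
       deg G v ≡ 2 ×
       (∀ w → adj G v w ≡ true → w ≢ u → ℕ→ℚ (deg G w) ℚ.≤ M))
  × ℕ→ℚ (deg G x ℕ.+ deg G y) ℚ.≤ (ℕ→ℚ k - M) + ℕ→ℚ 2 )

-- Let G be a minimal graph (with respect to subgraphs) whose square is not
-- list (k+1)-colourable.  Each configuration C1, C2, C3 yields a nonempty set
-- D of vertices (the low-degree vertices of the configuration) such that a
-- list colouring of the square of G − D extends to one of G, contradicting
-- the choice of G.
--
-- The extension is greedy.  A partial colouring leaves a list U of vertices
-- uncoloured (U ⊇ D; in C3 also the hub u, whose colour in G − D may clash).
-- A vertex a can still be coloured when fewer than k+1 colours are blocked;
-- the blocked vertices are counted along the walks a–w–z, which gives at most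
-- d(w) of them through each neighbour w, and d(w) − 1 if w is uncoloured
-- ('budget').  So the whole of U can be coloured in order when each vertex has
-- total budget ≤ k ('GreedyOrder').  The restriction of a colouring of G − D
-- is a valid partial colouring as long as no two coloured vertices have a
-- common neighbour in D ('Separated'); this holds because every vertex of D
-- has degree ≤ 2 and a neighbour in U (or degree ≤ 1, for C1).

module Submission where

open import Defs
open import Data.Nat using (ℕ; _≤_)
open import Data.Rational using (ℚ; 0ℚ; _<_; _*_; _/_)
open import Data.Integer using (+_)
open import Data.Product using (_×_)
open import Relation.Nullary using (¬_)

open import Data.Nat using (suc; pred; _+_; _∸_; z≤n; s≤s)
open import Data.Nat.Properties
  using (≤-trans; ≤-reflexive; ≤-refl; suc[m]≤n⇒m≤pred[n]; pred[n]≤n; <⇒≱; +-mono-≤; +-cancelˡ-≤; +-comm;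
         m∸n+n≡m; m+[n∸m]≡n; module ≤-Reasoning)
open import Data.Nat.Tactic.RingSolver using (solve-∀)
open import Data.Nat.ListAction using (sum)
open import Data.Bool using (Bool; true; false; if_then_else_; _∧_)
open import Data.Bool.Properties using (∧-comm; ∧-conicalˡ; ∧-conicalʳ)
import Data.Bool.Properties as Bool
open import Data.Fin using (Fin)
import Data.Fin as Fin
open import Data.List using (List; []; _∷_; length; map; filter; allFin; concatMap)
open import Data.List.Properties using (length-removeAt′; length-map; length-++; length-filter; filter-notAll)
open import Data.List.Relation.Unary.Any using (here; there; _─_; index; any?)
import Data.List.Relation.Unary.All as All
import Data.List.Relation.Unary.All.Properties as All
open import Data.List.Relation.Unary.AllPairs using ([]; _∷_)
open import Data.List.Relation.Unary.Unique.Propositional using (Unique)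
import Data.List.Relation.Unary.Unique.Propositional.Properties as Unique
open import Data.List.Membership.Propositional using (_∈_; _∉_; lose; find)
open import Data.List.Membership.Propositional.Properties
  using (∈-map⁺; ∈-filter⁺; ∈-filter⁻; ∈-allFin; ∈-concatMap⁺)
import Data.List.Membership.DecPropositional as DecMembership
open import Data.List.Relation.Binary.Subset.Propositional using (_⊆_)
open import Data.Vec.Functional using (updateAt)
open import Data.Vec.Functional.Properties using (updateAt-updates; updateAt-minimal)
open import Data.Product using (_,_; ∃-syntax; proj₁; proj₂)
open import Data.Sum using (inj₁; inj₂)
open import Data.Unit using (⊤; tt)
open import Data.Empty using (⊥; ⊥-elim)
open import Function using (_∘_)
open import Relation.Nullary using (Dec; yes; no; ¬?; _×-dec_)
open import Relation.Binary.Definitions using (DecidableEquality)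
open import Relation.Binary.PropositionalEquality
  using (_≡_; _≢_; refl; trans; cong; cong₂; subst; subst₂; module ≡-Reasoning)
  renaming (sym to ≡-sym)

module _ {A : Set} where

  ∈-─⁺ : ∀ {x y} {xs : List A} (x∈xs : x ∈ xs) → y ∈ xs → y ≢ x → y ∈ (xs ─ x∈xs)
  ∈-─⁺ (here refl) (here refl) y≢x = ⊥-elim (y≢x refl)
  ∈-─⁺ (here refl) (there y∈xs) _   = y∈xs
  ∈-─⁺ (there _)   (here refl) _    = here refl
  ∈-─⁺ (there x∈xs) (there y∈xs) y≢x = there (∈-─⁺ x∈xs y∈xs y≢x)

  ∈-─⁻ : ∀ {x y} {xs : List A} (x∈xs : x ∈ xs) → y ∈ (xs ─ x∈xs) → y ∈ xs
  ∈-─⁻ (here _)     y∈        = there y∈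
  ∈-─⁻ (there _)    (here e)  = here e
  ∈-─⁻ (there x∈xs) (there y∈) = there (∈-─⁻ x∈xs y∈)

  ∉-─ : ∀ {x} {xs : List A} → Unique xs → (x∈xs : x ∈ xs) → x ∉ (xs ─ x∈xs)
  ∉-─ (x∉ ∷ _)  (here refl) x∈rest      = All.lookup x∉ x∈rest refl
  ∉-─ (w∉ ∷ _)  (there x∈xs) (here refl) = All.lookup w∉ x∈xs refl
  ∉-─ (_ ∷ uxs) (there x∈xs) (there x∈)  = ∉-─ uxs x∈xs x∈

  unique-─ : ∀ {x} {xs : List A} → Unique xs → (x∈xs : x ∈ xs) → Unique (xs ─ x∈xs)
  unique-─ (_ ∷ uxs)  (here _)     = uxs
  unique-─ (w∉ ∷ uxs) (there x∈xs) = All.─⁺ x∈xs w∉ ∷ unique-─ uxs x∈xs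

  sum-─ : ∀ (b : A → ℕ) {x} {xs : List A} (x∈xs : x ∈ xs) →
          sum (map b xs) ≡ b x + sum (map b (xs ─ x∈xs))
  sum-─ b (here refl) = refl
  sum-─ b {x} {w ∷ ws} (there x∈ws) = begin
      b w + sum (map b ws)                  ≡⟨ cong (_+_ (b w)) (sum-─ b x∈ws) ⟩
      b w + (b x + sum (map b (ws ─ x∈ws))) ≡⟨ exchange (b w) (b x) _ ⟩
      b x + (b w + sum (map b (ws ─ x∈ws))) ∎
    where
    open ≡-Reasoning
    exchange : ∀ p q r → p + (q + r) ≡ q + (p + r)
    exchange = solve-∀

  unique⊆⇒length≤ : ∀ {xs ys : List A} → Unique xs → xs ⊆ ys → length xs ≤ length ys
  unique⊆⇒length≤ {[]}     _           _     = z≤n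
  unique⊆⇒length≤ {x ∷ xs} {ys} (x∉xs ∷ uxs) xs⊆ys = begin
      suc (length xs)              ≤⟨ s≤s (unique⊆⇒length≤ uxs rest⊆) ⟩
      suc (length (ys ─ x∈ys))     ≡⟨ ≡-sym (length-removeAt′ ys (index x∈ys)) ⟩
      length ys                    ∎
    where
    open ≤-Reasoning
    x∈ys : x ∈ ys
    x∈ys = xs⊆ys (here refl)
    rest⊆ : xs ⊆ (ys ─ x∈ys)
    rest⊆ y∈xs = ∈-─⁺ x∈ys (xs⊆ys (there y∈xs)) (λ y≡x → All.lookup x∉xs y∈xs (≡-sym y≡x))

  fresh-member : DecidableEquality A → ∀ {xs ys : List A} →
                 Unique xs → suc (length ys) ≤ length xs → ∃[ w ] (w ∈ xs × w ∉ ys)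
  fresh-member _≟_ {xs} {ys} uxs longer with any? (λ w → ¬? (w ∈? ys)) xs
    where open DecMembership _≟_ using (_∈?_)
  ... | yes outside = find outside
  ... | no none     = ⊥-elim (<⇒≱ longer (unique⊆⇒length≤ uxs xs⊆ys))
    where
    open DecMembership _≟_ using (_∈?_)
    xs⊆ys : xs ⊆ ys
    xs⊆ys {w} w∈xs with w ∈? ys
    ... | yes w∈ys = w∈ys
    ... | no  w∉ys = ⊥-elim (none (lose w∈xs w∉ys))

  sum-map-mono : ∀ {f g : A → ℕ} (xs : List A) → (∀ {w} → w ∈ xs → f w ≤ g w) →
                 sum (map f xs) ≤ sum (map g xs)
  sum-map-mono []       _   = z≤n
  sum-map-mono (w ∷ ws) f≤g = +-mono-≤ (f≤g (here refl)) (sum-map-mono ws (f≤g ∘ there))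

  sum≤length : ∀ {b : A → ℕ} (xs : List A) → (∀ {w} → w ∈ xs → b w ≤ 1) → sum (map b xs) ≤ length xs
  sum≤length []       _    = z≤n
  sum≤length (w ∷ ws) b≤1 = +-mono-≤ (b≤1 (here refl)) (sum≤length ws (b≤1 ∘ there))

  sum-short : ∀ {b : A → ℕ} {m} (xs : List A) → length xs ≤ 1 → (∀ {w} → w ∈ xs → b w ≤ m) →
              sum (map b xs) ≤ m
  sum-short []          _         _   = z≤n
  sum-short {b} (w ∷ []) _        b≤m = subst (_≤ _) (≡-sym (+-comm (b w) 0)) (b≤m (here refl))
  sum-short (_ ∷ _ ∷ _) (s≤s ()) _

  length-concatMap : ∀ {B : Set} (f : A → List B) (xs : List A) →
                     length (concatMap f xs) ≡ sum (map (length ∘ f) xs)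
  length-concatMap f []       = refl
  length-concatMap f (w ∷ ws) = trans (length-++ (f w)) (cong (_+_ (length (f w))) (length-concatMap f ws))

  module _ {x y : A} {xs : List A} (x∈xs : x ∈ xs) (y∈xs : y ∈ xs) (x≢y : x ≢ y) where

    private
      y∈xs─x : y ∈ (xs ─ x∈xs)
      y∈xs─x = ∈-─⁺ x∈xs y∈xs (x≢y ∘ ≡-sym)

    others : List A
    others = xs ─ x∈xs ─ y∈xs─x

    length-others : length xs ≡ 2 + length others
    length-others = trans (length-removeAt′ xs (index x∈xs))
                          (cong suc (length-removeAt′ (xs ─ x∈xs) (index y∈xs─x)))

    sum-others : ∀ (b : A → ℕ) → sum (map b xs) ≡ b x + (b y + sum (map b others))
    sum-others b = trans (sum-─ b x∈xs) (cong (_+_ (b x)) (sum-─ b y∈xs─x))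

    others-member : Unique xs → ∀ {w} → w ∈ others → w ∈ xs × w ≢ x × w ≢ y
    others-member uxs w∈ =
      ∈-─⁻ x∈xs (∈-─⁻ y∈xs─x w∈) ,
      (λ { refl → ∉-─ uxs x∈xs (∈-─⁻ y∈xs─x w∈) }) ,
      (λ { refl → ∉-─ (unique-─ uxs x∈xs) y∈xs─x w∈ })

  sum-pair : ∀ (b : A → ℕ) {x y} {xs : List A} → length xs ≡ 2 →
             x ∈ xs → y ∈ xs → x ≢ y → sum (map b xs) ≡ b x + b y
  sum-pair b {x} {y} len x∈xs y∈xs x≢y
    with others x∈xs y∈xs x≢y | length-others x∈xs y∈xs x≢y | sum-others x∈xs y∈xs x≢y b
  ... | [] | _ | sum≡ = trans sum≡ (cong (_+_ (b x)) (+-comm (b y) 0))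
  ... | _ ∷ _ | len≡ | _ with () ← trans (≡-sym len) len≡

  sum-marked : ∀ (b : A → ℕ) {x y} {xs : List A} → Unique xs → x ∈ xs → y ∈ xs → x ≢ y →
               (∀ {w} → w ∈ xs → w ≢ x → w ≢ y → b w ≤ 1) →
               2 + sum (map b xs) ≤ length xs + (b x + b y)
  sum-marked b {x} {y} {xs} uxs x∈xs y∈xs x≢y light = begin
      2 + sum (map b xs)                    ≡⟨ cong (_+_ 2) (sum-others x∈xs y∈xs x≢y b) ⟩
      2 + (b x + (b y + sum (map b rest)))  ≤⟨ +-mono-≤ (≤-refl {2}) (+-mono-≤ (≤-refl {b x})
                                                 (+-mono-≤ (≤-refl {b y}) (sum≤length rest rest-light))) ⟩
      2 + (b x + (b y + length rest))       ≡⟨ regroup 2 (b x) (b y) (length rest) ⟩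
      (2 + length rest) + (b x + b y)       ≡⟨ cong (_+ (b x + b y)) (≡-sym (length-others x∈xs y∈xs x≢y)) ⟩
      length xs + (b x + b y)               ∎
    where
    open ≤-Reasoning
    rest : List A
    rest = others x∈xs y∈xs x≢y
    rest-light : ∀ {w} → w ∈ rest → b w ≤ 1
    rest-light w∈ with others-member x∈xs y∈xs x≢y uxs w∈
    ... | w∈xs , w≢x , w≢y = light w∈xs w≢x w≢y
    regroup : ∀ p q r s → p + (q + (r + s)) ≡ (p + s) + (q + r)
    regroup = solve-∀

module Neighbourhood (G : Graph) where

  V : Set
  V = Fin (n G)

  open DecMembership (Fin._≟_ {n G}) using (_∈?_; _∉?_)

  N : V → List V
  N v = filter (λ w → adj G v w Bool.≟ true) (allFin (n G))

  count≡length-filter : ∀ {B : Set} (p : B → Bool) (xs : List B) →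
    sum (map (λ w → if p w then 1 else 0) xs) ≡ length (filter (λ w → p w Bool.≟ true) xs)
  count≡length-filter p []       = refl
  count≡length-filter p (x ∷ xs) with p x
  ... | true  = cong suc (count≡length-filter p xs)
  ... | false = count≡length-filter p xs

  deg≡length-N : ∀ v → deg G v ≡ length (N v)
  deg≡length-N v = count≡length-filter (adj G v) (allFin (n G))

  N⁺ : ∀ {v w} → adj G v w ≡ true → w ∈ N v
  N⁺ {v} {w} e = ∈-filter⁺ (λ w → adj G v w Bool.≟ true) (∈-allFin w) e

  N⁻ : ∀ {v w} → w ∈ N v → adj G v w ≡ true
  N⁻ {v} w∈ = proj₂ (∈-filter⁻ (λ w → adj G v w Bool.≟ true) {xs = allFin (n G)} w∈)

  N-unique : ∀ v → Unique (N v)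
  N-unique v = Unique.filter⁺ (λ w → adj G v w Bool.≟ true) (Unique.allFin⁺ (n G))

  adj-sym : ∀ {u v} → adj G u v ≡ true → adj G v u ≡ true
  adj-sym {u} {v} e = trans (sym G v u) e

  distinct-neighbours : ∀ {w} (xs : List V) → Unique xs → (∀ {x} → x ∈ xs → adj G w x ≡ true) →
                        length xs ≤ deg G w
  distinct-neighbours {w} xs uxs adjacent =
    ≤-trans (unique⊆⇒length≤ uxs (N⁺ ∘ adjacent)) (≤-reflexive (≡-sym (deg≡length-N w)))

  Sq : V → V → Set
  Sq = SqAdj (whole G)

  Sq-sym : ∀ {s t} → Sq s t → Sq t s
  Sq-sym (s≢t , inj₁ e)               = s≢t ∘ ≡-sym , inj₁ (adj-sym e)
  Sq-sym (s≢t , inj₂ (w , e₁ , e₂))   = s≢t ∘ ≡-sym , inj₂ (w , adj-sym e₂ , adj-sym e₁)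

  -- When the vertices of U are uncoloured, a vertex sees at most 'budget U w'
  -- coloured vertices through its neighbour w: the d(w) neighbours of w, where
  -- the walk back to a stands for w itself, which does not count if w ∈ U.
  budget : List V → V → ℕ
  budget U w with w ∈? U
  ... | yes _ = pred (deg G w)
  ... | no  _ = deg G w

  budget≤deg : ∀ U w → budget U w ≤ deg G w
  budget≤deg U w with w ∈? U
  ... | yes _ = pred[n]≤n
  ... | no  _ = ≤-refl

  budget-∈ : ∀ {U w} → w ∈ U → budget U w ≡ pred (deg G w)
  budget-∈ {U} {w} w∈U with w ∈? U
  ... | yes _   = refl
  ... | no  w∉U = ⊥-elim (w∉U w∈U)

  budget-∉ : ∀ {U w} → w ∉ U → budget U w ≡ deg G w
  budget-∉ {U} {w} w∉U with w ∈? U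
  ... | yes w∈U = ⊥-elim (w∉U w∈U)
  ... | no  _   = refl

  -- U can be coloured greedily in the given order: each vertex, when coloured,
  -- sees at most k coloured vertices of its square neighbourhood.
  GreedyOrder : ℕ → List V → Set
  GreedyOrder k []      = ⊤
  GreedyOrder k (a ∷ U) = sum (map (budget U) (N a)) ≤ k × GreedyOrder k U

  greedyOrder-light : ∀ {k} (U : List V) → (∀ {a} → a ∈ U → sum (map (deg G) (N a)) ≤ k) →
                      GreedyOrder k U
  greedyOrder-light []      _     = tt
  greedyOrder-light (a ∷ U) light =
    ≤-trans (sum-map-mono (N a) (λ {w} _ → budget≤deg U w)) (light (here refl)) ,
    greedyOrder-light U (light ∘ there)

  Separated : List V → List V → Set
  Separated U D = ∀ {s t w} → w ∈ D → s ∉ U → t ∉ U → s ≢ t →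
                  adj G s w ≡ true → adj G w t ≡ true → ⊥

  separated-isolated : ∀ {U D} → (∀ {w} → w ∈ D → deg G w ≤ 1) → Separated U D
  separated-isolated low {s} {t} w∈D _ _ s≢t e₁ e₂ =
    <⇒≱ (≤-trans (distinct-neighbours (s ∷ t ∷ []) ((s≢t All.∷ All.[]) ∷ All.[] ∷ []) adjacent) ≤-refl)
        (low w∈D)
    where
    adjacent : ∀ {x} → x ∈ s ∷ t ∷ [] → adj G _ x ≡ true
    adjacent (here refl)         = adj-sym e₁
    adjacent (there (here refl)) = e₂

  -- A vertex of degree ≤ 2 with a neighbour in U has at most one neighbour outside U.
  separated-pendant : ∀ {U D} → (∀ {w} → w ∈ D → deg G w ≤ 2 × ∃[ p ] (p ∈ U × adj G w p ≡ true)) →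
                      Separated U D
  separated-pendant {U} low {s} {t} w∈D s∉U t∉U s≢t e₁ e₂ with low w∈D
  ... | deg≤2 , p , p∈U , e =
    <⇒≱ (distinct-neighbours (p ∷ s ∷ t ∷ []) distinct adjacent) deg≤2
    where
    outside : ∀ {x} → x ∉ U → p ≢ x
    outside x∉U refl = x∉U p∈U
    distinct : Unique (p ∷ s ∷ t ∷ [])
    distinct = (outside s∉U All.∷ outside t∉U All.∷ All.[]) ∷ (s≢t All.∷ All.[]) ∷ All.[] ∷ []
    adjacent : ∀ {x} → x ∈ p ∷ s ∷ t ∷ [] → adj G _ x ≡ true
    adjacent (here refl)                 = e
    adjacent (there (here refl))         = adj-sym e₁
    adjacent (there (there (here refl))) = e₂

  keep : List V → V → Bool
  keep D v with v ∈? D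
  ... | yes _ = false
  ... | no  _ = true

  keep-∉ : ∀ {D v} → v ∉ D → keep D v ≡ true
  keep-∉ {D} {v} v∉D with v ∈? D
  ... | yes v∈D = ⊥-elim (v∉D v∈D)
  ... | no  _   = refl

  keep-∈ : ∀ {D v} → v ∈ D → keep D v ≡ false
  keep-∈ {D} {v} v∈D with v ∈? D
  ... | yes _   = refl
  ... | no  v∉D = ⊥-elim (v∉D v∈D)

  deleteVertices : List V → Subgraph G
  deleteVertices D = record
    { S      = keep D
    ; E      = λ u v → adj G u v ∧ (keep D u ∧ keep D v)
    ; E-sym  = λ u v → cong₂ _∧_ (sym G u v) (∧-comm (keep D u) (keep D v))
    ; E-adj  = λ u v → ∧-conicalˡ (adj G u v) (keep D u ∧ keep D v)
    ; E-endˡ = λ u v e → ∧-conicalˡ (keep D u) (keep D v) (∧-conicalʳ (adj G u v) _ e)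
    }

  deleteVertices-proper : ∀ {D v} → v ∈ D → Proper (deleteVertices D)
  deleteVertices-proper v∈D = inj₁ (_ , keep-∈ v∈D)

module Extension (G : Graph) (k : ℕ) (L : Fin (n G) → List ℕ)
                 (L-unique : ∀ v → Unique (L v)) (L-length : ∀ v → length (L v) ≡ suc k) where

  open Neighbourhood G
  open DecMembership (Fin._≟_ {n G}) using (_∈?_; _∉?_)

  record Partial (U : List V) (c : V → ℕ) : Set where
    field
      from-lists : ∀ v → v ∉ U → c v ∈ L v
      proper     : ∀ s t → Sq s t → s ∉ U → t ∉ U → c s ≢ c t
  open Partial

  -- The vertex seen from a along the walk a–w–z: z itself, or w if z = a.
  seenThrough : V → V → V → V
  seenThrough a w z with z Fin.≟ a
  ... | yes _ = w
  ... | no  _ = z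

  seenThrough-back : ∀ a w → seenThrough a w a ≡ w
  seenThrough-back a w with a Fin.≟ a
  ... | yes _  = refl
  ... | no a≢a = ⊥-elim (a≢a refl)

  seenThrough-on : ∀ {a w z} → z ≢ a → seenThrough a w z ≡ z
  seenThrough-on {a} {w} {z} z≢a with z Fin.≟ a
  ... | yes z≡a = ⊥-elim (z≢a z≡a)
  ... | no  _   = refl

  -- The coloured vertices seen from a through its neighbour w, and through all
  -- neighbours: a list (with repetitions) containing every coloured vertex
  -- adjacent to a in the square.
  seen : List V → V → V → List V
  seen U a w = filter (_∉? U) (map (seenThrough a w) (N w))

  blocked : List V → V → List V
  blocked U a = concatMap (seen U a) (N a)

  blocked-covers : ∀ {U a t} → Sq a t → t ∉ U → t ∈ blocked U a
  blocked-covers {U} {a} {t} (_ , inj₁ a~t) t∉U =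
    ∈-concatMap⁺ (seen U a) (lose (N⁺ a~t) (∈-filter⁺ (_∉? U) seen-t (t∉U)))
    where
    seen-t : t ∈ map (seenThrough a t) (N t)
    seen-t = subst (_∈ map (seenThrough a t) (N t)) (seenThrough-back a t) (∈-map⁺ _ (N⁺ (adj-sym a~t)))
  blocked-covers {U} {a} {t} (a≢t , inj₂ (w , a~w , w~t)) t∉U =
    ∈-concatMap⁺ (seen U a) (lose (N⁺ a~w) (∈-filter⁺ (_∉? U) seen-t t∉U))
    where
    seen-t : t ∈ map (seenThrough a w) (N w)
    seen-t = subst (_∈ map (seenThrough a w) (N w)) (seenThrough-on (a≢t ∘ ≡-sym)) (∈-map⁺ _ (N⁺ w~t))

  seen-length : ∀ U {a w} → w ∈ N a → length (seen U a w) ≤ budget U w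
  seen-length U {a} {w} w∈Na = by-membership (w ∈? U)
    where
    open ≤-Reasoning
    seen≤deg : length (seen U a w) ≤ deg G w
    seen≤deg = ≤-trans (length-filter (_∉? U) (map (seenThrough a w) (N w)))
                       (≤-reflexive (trans (length-map _ (N w)) (≡-sym (deg≡length-N w))))
    -- the walk a–w–a shows w itself, which is dropped when w is uncoloured
    a-seen : w ∈ map (seenThrough a w) (N w)
    a-seen = subst (_∈ map (seenThrough a w) (N w)) (seenThrough-back a w) (∈-map⁺ _ (N⁺ (adj-sym (N⁻ w∈Na))))
    by-membership : Dec (w ∈ U) → length (seen U a w) ≤ budget U w
    by-membership (yes w∈U) = subst (length (seen U a w) ≤_) (≡-sym (budget-∈ w∈U)) (suc[m]≤n⇒m≤pred[n] (begin-strict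
      length (seen U a w)                    <⟨ filter-notAll (_∉? U) (map (seenThrough a w) (N w)) (lose a-seen (λ w∉U → w∉U w∈U)) ⟩
      length (map (seenThrough a w) (N w))   ≡⟨ length-map _ (N w) ⟩
      length (N w)                           ≡⟨ ≡-sym (deg≡length-N w) ⟩
      deg G w                                ∎))
    by-membership (no w∉U) = subst (length (seen U a w) ≤_) (≡-sym (budget-∉ w∉U)) seen≤deg

  blocked-length : ∀ U a → length (blocked U a) ≤ sum (map (budget U) (N a))
  blocked-length U a = ≤-trans (≤-reflexive (length-concatMap (seen U a) (N a)))
                               (sum-map-mono (N a) (seen-length U))

  extend : ∀ {a U c} → Partial (a ∷ U) c → length (blocked U a) ≤ k → ∃[ c′ ] Partial U c′
  extend {a} {U} {c} P few with fresh-member Data.Nat._≟_ (L-unique a) bound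
    where
    bound : suc (length (map c (blocked U a))) ≤ length (L a)
    bound = subst₂ _≤_ (cong suc (≡-sym (length-map c (blocked U a)))) (≡-sym (L-length a)) (s≤s few)
  ... | x , x∈La , x-free = c′ , record { from-lists = lists ; proper = prop }
    where
    c′ : V → ℕ
    c′ = updateAt c a (λ _ → x)
    c′-a : c′ a ≡ x
    c′-a = updateAt-updates a c
    c′-other : ∀ {v} → v ≢ a → c′ v ≡ c v
    c′-other {v} v≢a = updateAt-minimal v a c v≢a
    still-uncoloured : ∀ {v} → v ≢ a → v ∉ U → v ∉ a ∷ U
    still-uncoloured v≢a _   (here v≡a) = v≢a v≡a
    still-uncoloured _   v∉U (there v∈U) = v∉U v∈U
    new≢ : ∀ {t} → Sq a t → t ∉ U → c′ a ≢ c′ t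
    new≢ {t} sq t∉U eq = x-free (subst (_∈ map c (blocked U a)) (≡-sym x≡ct) (∈-map⁺ c (blocked-covers sq t∉U)))
      where x≡ct : x ≡ c t
            x≡ct = trans (≡-sym c′-a) (trans eq (c′-other (proj₁ sq ∘ ≡-sym)))
    lists : ∀ v → v ∉ U → c′ v ∈ L v
    lists v v∉U with v Fin.≟ a
    ... | yes refl = subst (_∈ L a) (≡-sym c′-a) x∈La
    ... | no  v≢a  = subst (_∈ L v) (≡-sym (c′-other v≢a)) (from-lists P v (still-uncoloured v≢a v∉U))
    prop : ∀ s t → Sq s t → s ∉ U → t ∉ U → c′ s ≢ c′ t
    prop s t sq s∉U t∉U with s Fin.≟ a | t Fin.≟ a
    ... | yes refl | yes refl = ⊥-elim (proj₁ sq refl)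
    ... | yes refl | no  _    = new≢ sq t∉U
    ... | no  _    | yes refl = new≢ (Sq-sym sq) s∉U ∘ ≡-sym
    ... | no  s≢a  | no  t≢a  = subst₂ _≢_ (≡-sym (c′-other s≢a)) (≡-sym (c′-other t≢a))
                                  (proper P s t sq (still-uncoloured s≢a s∉U) (still-uncoloured t≢a t∉U))

  colour-greedily : ∀ U {c} → Partial U c → GreedyOrder k U → ∃[ c′ ] Partial [] c′
  colour-greedily []      P _               = _ , P
  colour-greedily (a ∷ U) P (bound , order) with extend P (≤-trans (blocked-length U a) bound)
  ... | _ , P′ = colour-greedily U P′ order

  restrict : ∀ {D U c} → (∀ {v} → v ∈ D → v ∈ U) → Separated U D →
             (∀ v → S (deleteVertices D) v ≡ true → c v ∈ L v) →
             (∀ s t → SqAdj (deleteVertices D) s t → c s ≢ c t) → Partial U c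
  restrict {D} {U} {c} D⊆U separated lists proper-D = record
    { from-lists = λ v v∉U → lists v (kept v∉U) ; proper = prop }
    where
    kept : ∀ {v} → v ∉ U → keep D v ≡ true
    kept v∉U = keep-∉ (v∉U ∘ D⊆U)
    edge : ∀ {u v} → adj G u v ≡ true → keep D u ≡ true → keep D v ≡ true →
           adj G u v ∧ (keep D u ∧ keep D v) ≡ true
    edge e ku kv rewrite e | ku | kv = refl
    prop : ∀ s t → Sq s t → s ∉ U → t ∉ U → c s ≢ c t
    prop s t (s≢t , inj₁ s~t) s∉U t∉U = proper-D s t (s≢t , inj₁ (edge s~t (kept s∉U) (kept t∉U)))
    prop s t (s≢t , inj₂ (w , s~w , w~t)) s∉U t∉U with w ∈? D
    ... | yes w∈D = ⊥-elim (separated w∈D s∉U t∉U s≢t s~w w~t)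
    ... | no  w∉D = proper-D s t (s≢t , inj₂ (w , edge s~w (kept s∉U) (keep-∉ w∉D) ,
                                                   edge w~t (keep-∉ w∉D) (kept t∉U)))

  complete : ∀ {c} → Partial [] c →
             (∀ v → S (whole G) v ≡ true → c v ∈ L v) × (∀ s t → SqAdj (whole G) s t → c s ≢ c t)
  complete P = (λ v _ → from-lists P v λ ()) , (λ s t sq → proper P s t sq (λ ()) (λ ()))

module Minimal (G : Graph) (k : ℕ) (max-deg : ∀ v → deg G v ≤ k)
               (not-colourable : ¬ SqListColourable (whole G) k)
               (minimal : (H : Subgraph G) → Proper H → SqListColourable H k) where

  open Neighbourhood G

  reducible : ∀ {v} (D U : List V) → v ∈ D → (∀ {w} → w ∈ D → w ∈ U) →
              Separated U D → GreedyOrder k U → ⊥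
  reducible D U v∈D D⊆U separated order = not-colourable colouring
    where
    colouring : SqListColourable (whole G) k
    colouring L L-unique L-length
      with minimal (deleteVertices D) (deleteVertices-proper v∈D) L L-unique L-length
    ... | c , lists , proper
      with colour-greedily U (restrict D⊆U separated lists proper) order
      where open Extension G k L L-unique L-length
    ... | c′ , P = c′ , complete P
      where open Extension G k L L-unique L-length

  no-C1 : ¬ C1 G
  no-C1 (u , deg≤1) =
    reducible (u ∷ []) (u ∷ []) (here refl) (λ w∈ → w∈)
      (separated-isolated λ { (here refl) → deg≤1 })
      (greedyOrder-light (u ∷ [])
        λ { (here refl) → sum-short (N u) (subst (_≤ 1) (deg≡length-N u) deg≤1) (λ {w} _ → max-deg w) })

  -- (C2) a path w₁ u₁ u₂ w₂ with d(u₁) = d(u₂) = 2, d(w₁) ≤ k − 1, d(w₂) ≤ k − 2: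
  -- delete u₁ and u₂, then colour u₁ (while u₂ is uncoloured) and u₂.
  no-C2 : ¬ C2 G k
  no-C2 (w₁ , u₁ , u₂ , w₂ , w₁~u₁ , u₁~u₂ , u₂~w₂ , w₁≢u₂ , w₂≢u₁ , d₁ , d₂ , dw₁ , dw₂) =
    reducible U U (here refl) (λ w∈ → w∈) separated (first , second , tt)
    where
    U : List V
    U = u₁ ∷ u₂ ∷ []
    k≥2 : 2 ≤ k
    k≥2 = subst (_≤ k) d₁ (max-deg u₁)
    separated : Separated U U
    separated = separated-pendant λ
      { (here refl)         → ≤-reflexive d₁ , u₂ , there (here refl) , u₁~u₂
      ; (there (here refl)) → ≤-reflexive d₂ , u₁ , here refl , adj-sym u₁~u₂ }
    first : sum (map (budget (u₂ ∷ [])) (N u₁)) ≤ k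
    first = begin
      sum (map (budget (u₂ ∷ [])) (N u₁))
        ≡⟨ sum-pair (budget (u₂ ∷ [])) (trans (≡-sym (deg≡length-N u₁)) d₁)
                    (N⁺ (adj-sym w₁~u₁)) (N⁺ u₁~u₂) w₁≢u₂ ⟩
      budget (u₂ ∷ []) w₁ + budget (u₂ ∷ []) u₂
        ≤⟨ +-mono-≤ (≤-trans (budget≤deg (u₂ ∷ []) w₁) dw₁)
                    (≤-reflexive (trans (budget-∈ (here refl)) (cong pred d₂))) ⟩
      (k ∸ 1) + 1 ≡⟨ m∸n+n≡m (≤-trans (s≤s z≤n) k≥2) ⟩
      k           ∎
      where open ≤-Reasoning
    second : sum (map (budget []) (N u₂)) ≤ k
    second = begin
      sum (map (budget []) (N u₂)) ≤⟨ sum-map-mono (N u₂) (λ {w} _ → budget≤deg [] w) ⟩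
      sum (map (deg G) (N u₂))
        ≡⟨ sum-pair (deg G) (trans (≡-sym (deg≡length-N u₂)) d₂)
                    (N⁺ (adj-sym u₁~u₂)) (N⁺ u₂~w₂) (w₂≢u₁ ∘ ≡-sym) ⟩
      deg G u₁ + deg G w₂          ≤⟨ +-mono-≤ (≤-reflexive d₁) dw₂ ⟩
      2 + (k ∸ 2)                  ≡⟨ m+[n∸m]≡n k≥2 ⟩
      k                            ∎
      where open ≤-Reasoning

  -- (C3) with the degree conditions in the form the argument uses: a hub u with
  -- d(u) ≥ 3, neighbours x ≠ y with d(u) + d(x) + d(y) ≤ k + 2, and all other
  -- neighbours ('spokes') of degree 2 whose other neighbour w has d(u) + d(w) ≤ k.
  -- Delete the spokes; colour u first (spokes uncoloured), then the spokes.
  no-hub : ∀ {u x y} → 3 ≤ deg G u → adj G u x ≡ true → adj G u y ≡ true → x ≢ y →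
           (∀ v → adj G u v ≡ true → v ≢ x → v ≢ y →
              deg G v ≡ 2 × (∀ w → adj G v w ≡ true → w ≢ u → deg G u + deg G w ≤ k)) →
           deg G u + (deg G x + deg G y) ≤ k + 2 → ⊥
  no-hub {u} {x} {y} deg≥3 u~x u~y x≢y spoke-cond hub-cond =
    reducible spokes (u ∷ spokes) (proj₂ some-spoke) there separated
              (hub-bound , greedyOrder-light spokes spoke-bound)
    where
    Spoke : V → Set
    Spoke v = adj G u v ≡ true × v ≢ x × v ≢ y
    spoke? : ∀ v → Dec (Spoke v)
    spoke? v = (adj G u v Bool.≟ true) ×-dec (¬? (v Fin.≟ x) ×-dec ¬? (v Fin.≟ y))
    spokes : List V
    spokes = filter spoke? (allFin (n G))
    spoke⁺ : ∀ {v} → Spoke v → v ∈ spokes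
    spoke⁺ {v} = ∈-filter⁺ spoke? (∈-allFin v)
    spoke⁻ : ∀ {v} → v ∈ spokes → Spoke v
    spoke⁻ v∈ = proj₂ (∈-filter⁻ spoke? {xs = allFin (n G)} v∈)
    some-spoke : ∃[ v ] v ∈ spokes
    some-spoke with fresh-member Fin._≟_ {ys = x ∷ y ∷ []} (N-unique u) (subst (3 ≤_) (deg≡length-N u) deg≥3)
    ... | v , v∈Nu , v∉xy = v , spoke⁺ (N⁻ v∈Nu , v∉xy ∘ here , v∉xy ∘ there ∘ here)
    separated : Separated (u ∷ spokes) spokes
    separated = separated-pendant λ w∈ →
      let (u~w , w≢x , w≢y) = spoke⁻ w∈
      in ≤-reflexive (proj₁ (spoke-cond _ u~w w≢x w≢y)) , u , here refl , adj-sym u~w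
    -- u sees one vertex through each spoke, and d(x), d(y) through x and y
    hub-bound : sum (map (budget spokes) (N u)) ≤ k
    hub-bound = +-cancelˡ-≤ 2 _ _ (begin
      2 + sum (map (budget spokes) (N u))
        ≤⟨ sum-marked (budget spokes) (N-unique u) (N⁺ u~x) (N⁺ u~y) x≢y spoke-budget ⟩
      length (N u) + (budget spokes x + budget spokes y)
        ≤⟨ +-mono-≤ (≤-reflexive (≡-sym (deg≡length-N u)))
                    (+-mono-≤ (budget≤deg spokes x) (budget≤deg spokes y)) ⟩
      deg G u + (deg G x + deg G y) ≤⟨ hub-cond ⟩
      k + 2                         ≡⟨ +-comm k 2 ⟩
      2 + k                         ∎)
      where
      open ≤-Reasoning
      spoke-budget : ∀ {w} → w ∈ N u → w ≢ x → w ≢ y → budget spokes w ≤ 1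
      spoke-budget w∈ w≢x w≢y =
        ≤-reflexive (trans (budget-∈ (spoke⁺ (N⁻ w∈ , w≢x , w≢y)))
                           (cong pred (proj₁ (spoke-cond _ (N⁻ w∈) w≢x w≢y))))
    -- a spoke's two neighbours are u and its far end w
    spoke-bound : ∀ {v} → v ∈ spokes → sum (map (deg G) (N v)) ≤ k
    spoke-bound {v} v∈ with spoke⁻ v∈
    ... | u~v , v≢x , v≢y with spoke-cond v u~v v≢x v≢y
    ... | deg-v , far-end
      with fresh-member Fin._≟_ {ys = u ∷ []} (N-unique v)
                        (≤-reflexive (≡-sym (trans (≡-sym (deg≡length-N v)) deg-v)))
    ... | w , w∈Nv , w∉u =
      subst (_≤ k) (≡-sym (sum-pair (deg G) (trans (≡-sym (deg≡length-N v)) deg-v)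
                                    (N⁺ (adj-sym u~v)) w∈Nv (λ u≡w → w∉u (here (≡-sym u≡w)))))
            (far-end w (N⁻ w∈Nv) (w∉u ∘ here))

-- The parameters: with ε ≤ 1/20, M = 6/ε and k ≥ 3/ε², two degrees ≤ M sum to ≤ k.

module Parameters where

  open import Data.Rational as ℚ using (mkℚ; 1ℚ; _-_; *≤*)
  import Data.Rational.Properties as ℚ
  import Data.Integer as ℤ
  import Data.Integer.Properties as ℤ
  import Data.Nat.Coprimality as Coprime
  open import Data.Rational.Solver using (module +-*-Solver)
  open +-*-Solver using (solve; _:+_; _:-_; _:*_; _:=_)
  open import Relation.Nullary.Decidable using (toWitness)

  ℕ→ℚ-normal : ∀ m → ℕ→ℚ m ≡ mkℚ (+ m) 0 (Coprime.sym (Coprime.1-coprimeTo m))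
  ℕ→ℚ-normal m = ℚ.normalize-coprime (Coprime.sym (Coprime.1-coprimeTo m))

  ℕ→ℚ-reflects-≤ : ∀ a b → ℕ→ℚ a ℚ.≤ ℕ→ℚ b → a ≤ b
  ℕ→ℚ-reflects-≤ a b a≤b rewrite ℕ→ℚ-normal a | ℕ→ℚ-normal b with a≤b
  ... | *≤* a≤b′ = ℤ.drop‿+≤+ (subst₂ ℤ._≤_ (ℤ.*-identityʳ (+ a)) (ℤ.*-identityʳ (+ b)) a≤b′)

  ℕ→ℚ-+ : ∀ a b → ℕ→ℚ (a + b) ≡ ℕ→ℚ a ℚ.+ ℕ→ℚ b
  ℕ→ℚ-+ a b rewrite ℕ→ℚ-normal a | ℕ→ℚ-normal b =
    cong (_/ 1) (≡-sym (cong₂ ℤ._+_ (ℤ.*-identityʳ (+ a)) (ℤ.*-identityʳ (+ b))))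

  20≤1/ε : (ε : ℚ) (ε-pos : 0ℚ < ε) → ε ℚ.≤ + 1 / 20 → ℕ→ℚ 20 ℚ.≤ inv ε ε-pos
  20≤1/ε ε ε-pos ε≤1/20 = ℚ.*-cancelʳ-≤-pos ε {{ℚ.positive ε-pos}} (begin
      ℕ→ℚ 20 * ε         ≤⟨ ℚ.*-monoˡ-≤-nonNeg (ℕ→ℚ 20) ε≤1/20 ⟩
      ℕ→ℚ 20 * (+ 1 / 20) ≡⟨ refl ⟩
      1ℚ                  ≡⟨ ≡-sym (ℚ.*-inverseˡ ε {{ℚ.pos⇒nonZero ε {{ℚ.positive ε-pos}}}}) ⟩
      inv ε ε-pos * ε     ∎)
    where open ℚ.≤-Reasoning

  two-below-M : (ε : ℚ) (ε-pos : 0ℚ < ε) → ε ℚ.≤ + 1 / 20 →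
                ∀ k → ℕ→ℚ 3 * inv ε ε-pos * inv ε ε-pos ℚ.≤ ℕ→ℚ k →
                ∀ {a b} → ℕ→ℚ a ℚ.≤ Mof ε ε-pos → ℕ→ℚ b ℚ.≤ Mof ε ε-pos → a + b ≤ k
  two-below-M ε ε-pos ε≤1/20 k k-large {a} {b} a≤M b≤M = ℕ→ℚ-reflects-≤ _ _ (begin
      ℕ→ℚ (a + b)               ≡⟨ ℕ→ℚ-+ a b ⟩
      ℕ→ℚ a ℚ.+ ℕ→ℚ b           ≤⟨ ℚ.+-mono-≤ a≤M b≤M ⟩
      ℕ→ℚ 6 * i ℚ.+ ℕ→ℚ 6 * i   ≡⟨ solve 2 (λ s j → s :* j :+ s :* j := (s :+ s) :* j) refl (ℕ→ℚ 6) i ⟩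
      ℕ→ℚ 12 * i                ≤⟨ ℚ.*-monoʳ-≤-nonNeg i (toWitness {a? = ℕ→ℚ 12 ℚ.≤? ℕ→ℚ 60} tt) ⟩
      (ℕ→ℚ 3 * ℕ→ℚ 20) * i      ≡⟨ solve 3 (λ t w j → (t :* w) :* j := (t :* j) :* w) refl (ℕ→ℚ 3) (ℕ→ℚ 20) i ⟩
      (ℕ→ℚ 3 * i) * ℕ→ℚ 20      ≤⟨ ℚ.*-monoˡ-≤-nonNeg (ℕ→ℚ 3 * i) (20≤1/ε ε ε-pos ε≤1/20) ⟩
      ℕ→ℚ 3 * i * i             ≤⟨ k-large ⟩
      ℕ→ℚ k                     ∎)
    where
    open ℚ.≤-Reasoning
    i : ℚ
    i = inv ε ε-pos
    instance
      i-pos : ℚ.Positive i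
      i-pos = ℚ.1/pos⇒pos ε {{ℚ.positive ε-pos}}
      i-nonNeg : ℚ.NonNegative i
      i-nonNeg = ℚ.pos⇒nonNeg i
      3i-nonNeg : ℚ.NonNegative (ℕ→ℚ 3 * i)
      3i-nonNeg = ℚ.pos⇒nonNeg (ℕ→ℚ 3 * i) {{ℚ.pos*pos⇒pos (ℕ→ℚ 3) i}}

  hub-below : ∀ (M : ℚ) k {du dxy} → ℕ→ℚ du ℚ.≤ M → ℕ→ℚ dxy ℚ.≤ (ℕ→ℚ k - M) ℚ.+ ℕ→ℚ 2 →
              du + dxy ≤ k + 2
  hub-below M k {du} {dxy} du≤M dxy≤ = ℕ→ℚ-reflects-≤ _ _ (begin
      ℕ→ℚ (du + dxy)                  ≡⟨ ℕ→ℚ-+ du dxy ⟩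
      ℕ→ℚ du ℚ.+ ℕ→ℚ dxy              ≤⟨ ℚ.+-mono-≤ du≤M dxy≤ ⟩
      M ℚ.+ ((ℕ→ℚ k - M) ℚ.+ ℕ→ℚ 2)   ≡⟨ solve 3 (λ m K t → m :+ ((K :- m) :+ t) := K :+ t) refl M (ℕ→ℚ k) (ℕ→ℚ 2) ⟩
      ℕ→ℚ k ℚ.+ ℕ→ℚ 2                 ≡⟨ ≡-sym (ℕ→ℚ-+ k 2) ⟩
      ℕ→ℚ (k + 2)                     ∎)
    where open ℚ.≤-Reasoning

lemma2 : (ε : ℚ) → (ε-pos : 0ℚ < ε) → ε Data.Rational.≤ + 1 / 20 →
    (k : ℕ) → ℕ→ℚ 3 * inv ε ε-pos * inv ε ε-pos Data.Rational.≤ ℕ→ℚ k →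
    (G : Graph) → (∀ v → deg G v ≤ k) →
    ¬ SqListColourable (whole G) k →
    ((H : Subgraph G) → Proper H → SqListColourable H k) →
    ¬ C1 G × ¬ C2 G k × ¬ C3 G k (Mof ε ε-pos)
lemma2 ε ε-pos ε≤1/20 k k-large G max-deg not-colourable minimal = no-C1 , no-C2 , no-C3
  where
  open Minimal G k max-deg not-colourable minimal
  open Parameters
  no-C3 : ¬ C3 G k (Mof ε ε-pos)
  no-C3 (u , x , y , deg≥3 , du≤M , u~x , u~y , x≢y , spokes , dxy≤) =
    no-hub deg≥3 u~x u~y x≢y
      (λ v u~v v≢x v≢y → let (deg-v , far) = spokes v u~v v≢x v≢y in
        deg-v , λ w v~w w≢u → two-below-M ε ε-pos ε≤1/20 k k-large {deg G u} {deg G w} du≤M (far w v~w w≢u))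
      (hub-below (Mof ε ε-pos) k {deg G u} {deg G x + deg G y} du≤M dxy≤)
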